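{- Let $G=(X,Y,E)$ be a $P_8$-free bipartite graph, let $N_0$ be a nonempty vertex set, and for $i\ge 1$ let $N_i$ be the set of vertices at distance exactly $i$ from $N_0$. Assume that every vertex of $N_2$ is an endpoint of an induced $P_5$ whose other four vertices all lie in $N_0\cup N_1$. Then for every $v\in N_3$ and every $w\in N_4$, $N(v)\cap N(w)=\emptyset$.
   Context: $N(v)$ denotes the (open) neighborhood of $v$. $P_k$ is the chordless path on $k$ vertices; $P_8$-free means no induced $P_8$. -}

module Defs where

open import Level using (0ℓ)
open import Data.Nat using (ℕ; zero; suc; _<_)
open import Data.Fin using (Fin; toℕ)
open import Data.Bool using (Bool)
open import Data.Product using (Σ; ∃; _×_; _,_)
open import Data.Sum using (_⊎_)
open import Relation.Nullary using (¬_)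
open import Relation.Unary using (Pred)
open import Relation.Binary.PropositionalEquality using (_≡_; _≢_)
open import Function.Definitions using (Injective)

record Graph (n : ℕ) : Set₁ where
  field
    Adj     : Fin n → Fin n → Set
    sym     : ∀ {u v} → Adj u v → Adj v u
    irrefl  : ∀ {u} → ¬ Adj u u
open Graph public

-- Bipartite: vertices 2-colourable (X = colour false, Y = colour true)
-- with every edge joining the two sides.
Bipartite : ∀ {n} → Graph n → Set
Bipartite {n} G = Σ (Fin n → Bool) λ c → ∀ {u v} → Adj G u v → c u ≢ c v

data Walk {n} (G : Graph n) : Fin n → Fin n → ℕ → Set where
  here : ∀ {u} → Walk G u u zero
  step : ∀ {u v w k} → Adj G u v → Walk G v w k → Walk G u w (suc k)

DistFrom : ∀ {n} → Graph n → Pred (Fin n) 0ℓ → ℕ → Fin n → Set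
DistFrom G S i v =
  (∃ λ u → S u × Walk G u v i) ×
  (∀ j → j < i → ∀ u → S u → ¬ Walk G u v j)

Consecutive : ∀ {k} → Fin k → Fin k → Set
Consecutive i j = suc (toℕ i) ≡ toℕ j ⊎ suc (toℕ j) ≡ toℕ i

record InducedPath {n} (G : Graph n) (k : ℕ) : Set where
  field
    vert    : Fin k → Fin n
    inj     : Injective _≡_ _≡_ vert
    adj→con : ∀ i j → Adj G (vert i) (vert j) → Consecutive i j
    con→adj : ∀ i j → Consecutive i j → Adj G (vert i) (vert j)
open InducedPath public

PFree : ∀ {n} → Graph n → ℕ → Set
PFree G k = ¬ InducedPath G k

-- A vertex v ∈ N₃ has a neighbour u ∈ N₂, which ends an induced P₅ inside N₀ ∪ N₁ ∪ {u}.
-- If v and w ∈ N₄ had a common neighbour x, then that P₅ followed by v, x, w would be an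
-- induced P₈: the distance layers forbid every chord except u–x and v–w, and those two
-- would close triangles, which a bipartite graph does not have.

module Submission where

open import Defs
open import Level using (0ℓ)
open import Data.Nat using (ℕ; zero; suc; _≤_; _∸_; s≤s; s≤s⁻¹)
open import Data.Nat.Properties using (≤-trans; ≤-refl; n≤1+n; +-∸-assoc)
import Data.Nat.Properties as ℕ
open import Data.Fin using (Fin; zero; suc; toℕ; opposite; fromℕ)
open import Data.Fin.Properties using (toℕ<n; opposite-prop; opposite-involutive)
open import Data.Vec.Functional using (_∷_)
open import Data.Bool.Properties using (¬-not)
open import Data.Product using (Σ; ∃; _×_; _,_)
open import Data.Sum using (_⊎_; inj₁; inj₂; [_,_]; swap)
import Data.Sum as Sum
open import Data.Empty using (⊥-elim)
open import Relation.Nullary using (¬_)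
open import Relation.Unary using (Pred)
open import Relation.Binary.PropositionalEquality using (_≡_; _≢_; refl; cong; subst; subst₂; module ≡-Reasoning)
import Relation.Binary.PropositionalEquality as ≡

bipartite⇒¬triangle : ∀ {n} (G : Graph n) → Bipartite G →
  ∀ {a b c} → Adj G a b → Adj G b c → ¬ Adj G a c
bipartite⇒¬triangle G (_ , proper) ab bc ac =
  proper ac (≡.trans (¬-not (proper ab)) (≡.sym (¬-not (λ e → proper bc (≡.sym e)))))

consecutive-suc⁻¹ : ∀ {k} {i j : Fin k} → Consecutive (suc i) (suc j) → Consecutive i j
consecutive-suc⁻¹ = Sum.map ℕ.suc-injective ℕ.suc-injective

consecutive-suc : ∀ {k} {i j : Fin k} → Consecutive i j → Consecutive (suc i) (suc j)
consecutive-suc = Sum.map (cong suc) (cong suc)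

opposite-successor : ∀ {k} {i j : Fin k} → suc (toℕ i) ≡ toℕ j →
  suc (toℕ (opposite j)) ≡ toℕ (opposite i)
opposite-successor {suc m} {i} {j} e = begin
  suc (toℕ (opposite j))  ≡⟨ cong suc (opposite-prop j) ⟩
  suc (m ∸ toℕ j)         ≡⟨ cong (λ b → suc (m ∸ b)) (≡.sym e) ⟩
  suc (m ∸ suc (toℕ i))   ≡⟨ +-∸-assoc 1 i<m ⟨
  m ∸ toℕ i               ≡⟨ opposite-prop i ⟨
  toℕ (opposite i)        ∎
  where
  open ≡-Reasoning
  i<m : suc (toℕ i) ≤ m
  i<m = subst (_≤ m) (≡.sym e) (s≤s⁻¹ (toℕ<n j))

consecutive-opposite : ∀ {k} {i j : Fin k} → Consecutive i j →
  Consecutive (opposite i) (opposite j)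
consecutive-opposite (inj₁ e) = inj₂ (opposite-successor e)
consecutive-opposite (inj₂ e) = inj₁ (opposite-successor e)

opposite-injective : ∀ {k} {i j : Fin k} → opposite i ≡ opposite j → i ≡ j
opposite-injective {i = i} {j} e = begin
  i                       ≡⟨ opposite-involutive i ⟨
  opposite (opposite i)   ≡⟨ cong opposite e ⟩
  opposite (opposite j)   ≡⟨ opposite-involutive j ⟩
  j                       ∎
  where open ≡-Reasoning

consecutive-opposite⁻¹ : ∀ {k} {i j : Fin k} → Consecutive (opposite i) (opposite j) →
  Consecutive i j
consecutive-opposite⁻¹ {i = i} {j} c =
  subst₂ Consecutive (opposite-involutive i) (opposite-involutive j) (consecutive-opposite c)

module _ {n} {G : Graph n} where

  walk-snoc : ∀ {u y z j} → Walk G u y j → Adj G y z → Walk G u z (suc j)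
  walk-snoc here         yz = step yz here
  walk-snoc (step uy′ W) yz = step uy′ (walk-snoc W yz)

  walk-unsnoc : ∀ {u z j} → Walk G u z (suc j) → ∃ λ y → Walk G u y j × Adj G y z
  walk-unsnoc (step uz here) = _ , here , uz
  walk-unsnoc (step uy (step yy′ W)) with walk-unsnoc (step yy′ W)
  ... | y , W′ , yz = y , step uy W′ , yz

  distFrom-pred : ∀ {S i z} → DistFrom G S (suc i) z →
    ∃ λ y → DistFrom G S i y × Adj G y z
  distFrom-pred ((u , Su , W) , minimal) with walk-unsnoc W
  ... | y , W′ , yz = y , ((u , Su , W′) , λ j j<i u′ Su′ W″ →
        minimal (suc j) (s≤s j<i) u′ Su′ (walk-snoc W″ yz)) , yz

  reversePath : ∀ {k} → InducedPath G k → InducedPath G k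
  reversePath P = record
    { vert    = λ i → vert P (opposite i)
    ; inj     = λ e → opposite-injective (inj P e)
    ; adj→con = λ i j a → consecutive-opposite⁻¹ (adj→con P (opposite i) (opposite j) a)
    ; con→adj = λ i j c → con→adj P (opposite i) (opposite j) (consecutive-opposite c)
    }

  consPath : ∀ {k} (P : InducedPath G (suc k)) (y : Fin n) →
    Adj G y (vert P zero) → (∀ i → ¬ Adj G y (vert P (suc i))) →
    (∀ i → y ≢ vert P (suc i)) → InducedPath G (suc (suc k))
  consPath {k} P y y~first y≁rest y∉rest = record
    { vert = y ∷ vert P ; inj = injective ; adj→con = adj⇒con ; con→adj = con⇒adj }
    where
    y≢ : ∀ i → y ≢ vert P i
    y≢ zero    e = irrefl G (subst (Adj G y) (≡.sym e) y~first)
    y≢ (suc i) = y∉rest i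

    injective : ∀ {i j} → (y ∷ vert P) i ≡ (y ∷ vert P) j → i ≡ j
    injective {zero}  {zero}  _ = refl
    injective {zero}  {suc j} e = ⊥-elim (y≢ j e)
    injective {suc i} {zero}  e = ⊥-elim (y≢ i (≡.sym e))
    injective {suc i} {suc j} e = cong suc (inj P e)

    y-adj⇒con : ∀ j → Adj G y (vert P j) → Consecutive {suc (suc k)} zero (suc j)
    y-adj⇒con zero    _ = inj₁ refl
    y-adj⇒con (suc j) a = ⊥-elim (y≁rest j a)

    adj⇒con : ∀ i j → Adj G ((y ∷ vert P) i) ((y ∷ vert P) j) → Consecutive i j
    adj⇒con zero    zero    a = ⊥-elim (irrefl G a)
    adj⇒con zero    (suc j) a = y-adj⇒con j a
    adj⇒con (suc i) zero    a = swap (y-adj⇒con i (sym G a))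
    adj⇒con (suc i) (suc j) a = consecutive-suc (adj→con P i j a)

    con⇒adj : ∀ i j → Consecutive i j → Adj G ((y ∷ vert P) i) ((y ∷ vert P) j)
    con⇒adj zero    zero          (inj₁ ())
    con⇒adj zero    zero          (inj₂ ())
    con⇒adj zero    (suc zero)    _         = y~first
    con⇒adj zero    (suc (suc j)) (inj₁ ())
    con⇒adj zero    (suc (suc j)) (inj₂ ())
    con⇒adj (suc zero)    zero    _         = sym G y~first
    con⇒adj (suc (suc i)) zero    (inj₁ ())
    con⇒adj (suc (suc i)) zero    (inj₂ ())
    con⇒adj (suc i) (suc j) c = con→adj P i j (consecutive-suc⁻¹ c)

module Layers {n} (G : Graph n) (N₀ : Pred (Fin n) 0ℓ) where

  Within : ℕ → Fin n → Set
  Within k y = Σ ℕ λ j → j ≤ k × ∃ λ u → N₀ u × Walk G u y j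

  within-suc : ∀ {k y} → Within k y → Within (suc k) y
  within-suc (j , j≤k , walk) = j , ≤-trans j≤k (n≤1+n _) , walk

  within-step : ∀ {k y z} → Within k y → Adj G y z → Within (suc k) z
  within-step (j , j≤k , u , N₀u , W) yz = suc j , s≤s j≤k , u , N₀u , walk-snoc W yz

  N₀⇒within : ∀ {y} → N₀ y → Within 0 y
  N₀⇒within N₀y = 0 , ≤-refl , _ , N₀y , here

  distFrom⇒within : ∀ {i y} → DistFrom G N₀ i y → Within i y
  distFrom⇒within ((u , N₀u , W) , _) = _ , ≤-refl , u , N₀u , W

  distFrom⇒¬within : ∀ {i y} → DistFrom G N₀ (suc i) y → ¬ Within i y
  distFrom⇒¬within (_ , minimal) (j , j≤i , u , N₀u , W) = minimal j (s≤s j≤i) u N₀u W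

  extendPath : ∀ {k} → Bipartite G → (Q : InducedPath G (suc k)) →
    Within 2 (vert Q zero) → (∀ i → Within 1 (vert Q (suc i))) →
    ∀ {v x w} → ¬ Within 2 v → ¬ Within 3 w →
    Adj G v (vert Q zero) → Adj G v x → Adj G w x → InducedPath G (suc (suc (suc (suc k))))
  extendPath {k} bip Q start rest {v} {x} {w} v-far w-far vq₀ vx wx = Pw
    where
    inQ : ∀ i → Within 2 (vert Q i)
    inQ zero    = start
    inQ (suc i) = within-suc (rest i)

    x-far : ¬ Within 2 x
    x-far x-near = w-far (within-step x-near (sym G wx))

    Pv : InducedPath G (suc (suc k))
    Pv = consPath Q v vq₀
      (λ i a → v-far (within-step (rest i) (sym G a)))
      (λ i e → v-far (subst (Within 2) (≡.sym e) (inQ (suc i))))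

    Px : InducedPath G (suc (suc (suc k)))
    Px = consPath Pv x (sym G vx) x≁ (λ i e → x-far (subst (Within 2) (≡.sym e) (inQ i)))
      where
      x≁ : ∀ i → ¬ Adj G x (vert Pv (suc i))
      x≁ zero    = bipartite⇒¬triangle G bip (sym G vx) vq₀
      x≁ (suc i) a = x-far (within-step (rest i) (sym G a))

    Pw : InducedPath G (suc (suc (suc (suc k))))
    Pw = consPath Px w wx w≁ w∉
      where
      w≁ : ∀ i → ¬ Adj G w (vert Px (suc i))
      w≁ zero    = bipartite⇒¬triangle G bip wx (sym G vx)
      w≁ (suc i) a = w-far (within-step (inQ i) (sym G a))

      w∉ : ∀ i → w ≢ vert Px (suc i)
      w∉ zero    e = w-far (subst (Within 3) (≡.sym e) (within-step (inQ zero) (sym G vq₀)))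
      w∉ (suc i) e = w-far (subst (Within 3) (≡.sym e) (within-suc (inQ i)))

  side⇒within : ∀ {y} → N₀ y ⊎ DistFrom G N₀ 1 y → Within 1 y
  side⇒within = [ (λ N₀y → within-suc (N₀⇒within N₀y)) , distFrom⇒within ]

  anchorFirst : ∀ {k u} (P : InducedPath G (suc k)) → vert P zero ≡ u →
    (∀ i → vert P i ≢ u → N₀ (vert P i) ⊎ DistFrom G N₀ 1 (vert P i)) →
    ∀ i → Within 1 (vert P (suc i))
  anchorFirst {u = u} P first side i = side⇒within (side (suc i) not-first)
    where
    not-first : vert P (suc i) ≢ u
    not-first e with inj P (≡.trans e (≡.sym first))
    ... | ()

  anchorPath : ∀ {k u} (P : InducedPath G (suc k)) →
    vert P zero ≡ u ⊎ vert P (fromℕ k) ≡ u →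
    (∀ i → vert P i ≢ u → N₀ (vert P i) ⊎ DistFrom G N₀ 1 (vert P i)) →
    ∃ λ (Q : InducedPath G (suc k)) → vert Q zero ≡ u × (∀ i → Within 1 (vert Q (suc i)))
  anchorPath P (inj₁ first) side = P , first , anchorFirst P first side
  anchorPath P (inj₂ last) side =
    reversePath P , last , anchorFirst (reversePath P) last (λ i → side (opposite i))

corollary2 : ∀ {n} (G : Graph n) → Bipartite G → PFree G 8 →
    (N₀ : Pred (Fin n) 0ℓ) → (∃ λ u → N₀ u) →
    (∀ v → DistFrom G N₀ 2 v →
      ∃ λ (P : InducedPath G 5) →
        (vert P zero ≡ v ⊎ vert P (suc (suc (suc (suc zero)))) ≡ v) ×
        (∀ i → vert P i ≢ v → N₀ (vert P i) ⊎ DistFrom G N₀ 1 (vert P i))) →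
    ∀ v w → DistFrom G N₀ 3 v → DistFrom G N₀ 4 w →
    ∀ x → ¬ (Adj G v x × Adj G w x)
corollary2 G bip P₈-free N₀ _ P₅-at v w v∈N₃ w∈N₄ x (vx , wx) = P₈-free P₈
  where
  open Layers G N₀
  P₈ : InducedPath G 8
  P₈ with distFrom-pred v∈N₃
  ... | u , u∈N₂ , uv with P₅-at u u∈N₂
  ... | P , ends , side with anchorPath P ends side
  ... | Q , refl , rest = extendPath bip Q (distFrom⇒within u∈N₂) rest
          (distFrom⇒¬within v∈N₃) (distFrom⇒¬within w∈N₄) (sym G uv) vx wx
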